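{- Let $G$ be a graph, and let $c\ge1$, $r\ge0$ be integers. Suppose there exist $c$ vertices $w_1,\dots,w_c\in V(G)$ such that for every $v\in V(G)$ there is $i\in\{1,\dots,c\}$ with $\operatorname{dist}_G(v,w_i)\le r$. Then $\operatorname{tw}(G)\le (2r+1)c\cdot\operatorname{ltw}(G)-1$.
   Context: All graphs are finite, simple and undirected. A layering of $G$ is a partition $(V_0,\dots,V_s)$ of $V(G)$ such that for every edge $vw$ with $v\in V_i$, $w\in V_j$ we have $|i-j|\le1$. The layered treewidth $\operatorname{ltw}(G)$ is the minimum integer $\ell$ such that for some tree decomposition of $G$ and some layering of $G$, every bag contains at most $\ell$ vertices of each layer. -}

module Defs where

open import Data.Nat using (ℕ; zero; suc; _≤_; _≟_)
open import Data.Fin using (Fin; zero; suc; toℕ)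
open import Data.Fin.Subset using (Subset; _∈_; _∩_; ∣_∣)
open import Data.Vec using (tabulate)
open import Data.Product using (Σ; _×_; ∃; ∃-syntax)
open import Data.Sum using (_⊎_)
open import Relation.Nullary using (¬_)
open import Relation.Nullary.Decidable using (⌊_⌋)
open import Relation.Binary.PropositionalEquality using (_≡_)

record Graph : Set₁ where
  field
    n       : ℕ
    Adj     : Fin n → Fin n → Set
    Adj-sym : ∀ {u v} → Adj u v → Adj v u
    Adj-irr : ∀ {v} → ¬ Adj v v

open Graph public

data Walk (G : Graph) : Fin (n G) → Fin (n G) → ℕ → Set where
  nil  : ∀ {v} → Walk G v v zero
  cons : ∀ {u x v k} → Adj G u x → Walk G x v k → Walk G u v (suc k)

DistLe : (G : Graph) → Fin (n G) → Fin (n G) → ℕ → Set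
DistLe G u v r = ∃[ k ] (k ≤ r × Walk G u v k)

-- A tree on node set Fin (suc m), presented by parent pointers:
-- node (suc i) has parent (parent i), whose index is ≤ i (node zero is the root).
-- Every finite tree has such a presentation (e.g. by BFS order).
record Tree : Set where
  field
    m       : ℕ
    parent  : Fin m → Fin (suc m)
    parent< : ∀ i → toℕ (parent i) ≤ toℕ i

open Tree public

data TAdj (T : Tree) : Fin (suc (m T)) → Fin (suc (m T)) → Set where
  up   : ∀ i → TAdj T (suc i) (parent T i)
  down : ∀ i → TAdj T (parent T i) (suc i)

data ConnIn (T : Tree) (P : Fin (suc (m T)) → Set) : Fin (suc (m T)) → Fin (suc (m T)) → Set where
  here : ∀ {s} → P s → ConnIn T P s s
  step : ∀ {s x t} → P s → TAdj T s x → ConnIn T P x t → ConnIn T P s t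

record TreeDecomp (G : Graph) : Set where
  field
    tree  : Tree
    bag   : Fin (suc (m tree)) → Subset (n G)
    cover : ∀ v → ∃[ t ] (v ∈ bag t)
    edge  : ∀ u v → Adj G u v → ∃[ t ] (u ∈ bag t × v ∈ bag t)
    conn  : ∀ v s t → v ∈ bag s → v ∈ bag t → ConnIn tree (λ x → v ∈ bag x) s t

open TreeDecomp public

TreewidthLe : Graph → ℕ → Set
TreewidthLe G k = Σ (TreeDecomp G) λ D → ∀ t → ∣ bag D t ∣ ≤ suc k

-- A layering, given by the layer index of each vertex (vertex v ∈ V_(layer v)).
IsLayering : (G : Graph) → (Fin (n G) → ℕ) → Set
IsLayering G layer = ∀ u v → Adj G u v → (layer u ≤ suc (layer v)) × (layer v ≤ suc (layer u))

layerSet : (G : Graph) → (Fin (n G) → ℕ) → ℕ → Subset (n G)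
layerSet G layer i = tabulate (λ v → ⌊ layer v ≟ i ⌋)

LayeredTreewidthLe : Graph → ℕ → Set
LayeredTreewidthLe G ℓ =
  Σ (TreeDecomp G) λ D → Σ (Fin (n G) → ℕ) λ layer →
    IsLayering G layer × (∀ t i → ∣ bag D t ∩ layerSet G layer i ∣ ≤ ℓ)

{-# OPTIONS --safe #-}
-- Keep the layered tree decomposition. Every vertex lies within distance r of some w_i,
-- and an edge changes the layer index by at most one, so all vertices lie in at most
-- (2r+1)c layers: the windows of width 2r+1 around the layers of the w_i. Hence each
-- bag, which meets every layer in at most ℓ vertices, has at most (2r+1)cℓ vertices.
module Submission where

open import Defs
open import Data.Nat using (ℕ; _+_; _*_; _∸_; _≤_)
open import Data.Fin using (Fin)
open import Data.Product using (∃-syntax)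

open import Data.Nat using (suc; _<_; z≤n; s≤s; _≟_; >-nonZero)
open import Data.Nat.Properties
open import Data.Nat.ListAction using (sum)
open import Data.Nat.Tactic.RingSolver using (solve-∀)
open import Data.Fin.Subset using (Subset; _∩_; _∪_; ⋃; ∣_∣; inside; outside; _⊆_)
  renaming (_∈_ to _∈ₛ_)
open import Data.Fin.Subset.Properties using (∣⊥∣≡0; p⊆q⇒∣p∣≤∣q∣; x∈p∩q⁺; x∈p∪q⁺)
open import Data.Vec using (_∷_; []; tabulate)
open import Data.Vec.Properties using (lookup⇒[]=; lookup∘tabulate)
open import Data.List using (List; []; _∷_; _++_; map; length; upTo; allFin; cartesianProductWith)
open import Data.List.Properties using (length-++; length-map; length-upTo; length-tabulate)
open import Data.List.Relation.Unary.Any using (here; there)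
open import Data.List.Membership.Propositional using (_∈_)
open import Data.List.Membership.Propositional.Properties
  using (∈-cartesianProductWith⁺; ∈-upTo⁺; ∈-allFin)
open import Data.Product using (_,_; _×_)
open import Data.Sum using (inj₁; inj₂)
open import Relation.Nullary.Decidable using (⌊_⌋; isYes≗does; dec-true)
open import Relation.Binary.PropositionalEquality

private
  variable
    A B C : Set
    N : ℕ

∣p∪q∣≤∣p∣+∣q∣ : (p q : Subset N) → ∣ p ∪ q ∣ ≤ ∣ p ∣ + ∣ q ∣
∣p∪q∣≤∣p∣+∣q∣ []            []            = z≤n
∣p∪q∣≤∣p∣+∣q∣ (outside ∷ p) (outside ∷ q) = ∣p∪q∣≤∣p∣+∣q∣ p q
∣p∪q∣≤∣p∣+∣q∣ (outside ∷ p) (inside ∷ q)  =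
  ≤-trans (s≤s (∣p∪q∣≤∣p∣+∣q∣ p q)) (≤-reflexive (sym (+-suc ∣ p ∣ ∣ q ∣)))
∣p∪q∣≤∣p∣+∣q∣ (inside ∷ p)  (outside ∷ q) = s≤s (∣p∪q∣≤∣p∣+∣q∣ p q)
∣p∪q∣≤∣p∣+∣q∣ (inside ∷ p)  (inside ∷ q)  =
  s≤s (≤-trans (∣p∪q∣≤∣p∣+∣q∣ p q) (+-monoʳ-≤ ∣ p ∣ (n≤1+n ∣ q ∣)))

∣⋃map∣≤sum : (g : A → Subset N) (xs : List A) → ∣ ⋃ (map g xs) ∣ ≤ sum (map (λ x → ∣ g x ∣) xs)
∣⋃map∣≤sum {N = N} g []       = ≤-reflexive (∣⊥∣≡0 N)
∣⋃map∣≤sum         g (x ∷ xs) =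
  ≤-trans (∣p∪q∣≤∣p∣+∣q∣ (g x) (⋃ (map g xs))) (+-monoʳ-≤ ∣ g x ∣ (∣⋃map∣≤sum g xs))

sum-map-≤ : (g : A → ℕ) (ℓ : ℕ) (xs : List A) → (∀ x → g x ≤ ℓ) → sum (map g xs) ≤ length xs * ℓ
sum-map-≤ g ℓ []       g≤ℓ = z≤n
sum-map-≤ g ℓ (x ∷ xs) g≤ℓ = +-mono-≤ (g≤ℓ x) (sum-map-≤ g ℓ xs g≤ℓ)

-- layerSet G layer k is definitionally fibre layer k.
fibre : (Fin N → ℕ) → ℕ → Subset N
fibre f k = tabulate (λ v → ⌊ f v ≟ k ⌋)

∈-fibre : (f : Fin N → ℕ) (v : Fin N) → v ∈ₛ fibre f (f v)
∈-fibre f v = lookup⇒[]= v (fibre f (f v))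
  (trans (lookup∘tabulate _ v) (trans (isYes≗does (f v ≟ f v)) (dec-true (f v ≟ f v) refl)))

⊆-⋃-fibres : (p : Subset N) (f : Fin N → ℕ) (ks : List ℕ) → (∀ {v} → v ∈ₛ p → f v ∈ ks)
  → p ⊆ ⋃ (map (λ k → p ∩ fibre f k) ks)
⊆-⋃-fibres p f ks colours {v} v∈p = go ks (colours v∈p)
  where
  go : ∀ ks → f v ∈ ks → v ∈ₛ ⋃ (map (λ k → p ∩ fibre f k) ks)
  go (k ∷ ks) (here refl) = x∈p∪q⁺ (inj₁ (x∈p∩q⁺ (v∈p , ∈-fibre f v)))
  go (k ∷ ks) (there fv∈ks) = x∈p∪q⁺ (inj₂ (go ks fv∈ks))

∣p∣≤sum∣p∩fibre∣ : (p : Subset N) (f : Fin N → ℕ) (ks : List ℕ) → (∀ {v} → v ∈ₛ p → f v ∈ ks)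
  → ∣ p ∣ ≤ sum (map (λ k → ∣ p ∩ fibre f k ∣) ks)
∣p∣≤sum∣p∩fibre∣ p f ks colours =
  ≤-trans (p⊆q⇒∣p∣≤∣q∣ (⊆-⋃-fibres p f ks colours)) (∣⋃map∣≤sum (λ k → p ∩ fibre f k) ks)

length-cartesianProductWith : (f : A → B → C) (xs : List A) (ys : List B)
  → length (cartesianProductWith f xs ys) ≡ length xs * length ys
length-cartesianProductWith f []       ys = refl
length-cartesianProductWith f (x ∷ xs) ys = begin
  length (map (f x) ys ++ cartesianProductWith f xs ys)
    ≡⟨ length-++ (map (f x) ys) ⟩
  length (map (f x) ys) + length (cartesianProductWith f xs ys)
    ≡⟨ cong₂ _+_ (length-map (f x) ys) (length-cartesianProductWith f xs ys) ⟩
  length ys + length xs * length ys ∎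
  where open ≡-Reasoning

module _ {G : Graph} {layer : Fin (n G) → ℕ} (isLayering : IsLayering G layer) where

  walk⇒layers-close : ∀ {u v k} → Walk G u v k → layer u ≤ k + layer v × layer v ≤ k + layer u
  walk⇒layers-close nil = ≤-refl , ≤-refl
  walk⇒layers-close {u} {k = suc k} (cons {x = x} u~x walk)
    with u≤x+1 , x≤u+1 ← isLayering u x u~x
       | x≤v+k , v≤x+k ← walk⇒layers-close walk =
    ≤-trans u≤x+1 (s≤s x≤v+k) ,
    ≤-trans v≤x+k (≤-trans (+-monoʳ-≤ k x≤u+1) (≤-reflexive (+-suc k (layer u))))

  distLe⇒layers-close : ∀ {u v r} → DistLe G u v r → layer u ≤ r + layer v × layer v ≤ r + layer u
  distLe⇒layers-close (k , k≤r , walk) with below , above ← walk⇒layers-close walk =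
    ≤-trans below (+-monoˡ-≤ _ k≤r) , ≤-trans above (+-monoˡ-≤ _ k≤r)

-- Truncated subtraction is harmless here: if a < r the window starts at 0 and still reaches a + r.
∃-offset-in-window : ∀ {a y} r → y ≤ r + a → a ≤ r + y → ∃[ d ] d < 2 * r + 1 × a ∸ r + d ≡ y
∃-offset-in-window {a} {y} r y≤r+a a≤r+y =
  y ∸ (a ∸ r) , m<n+o⇒m∸n<o y (a ∸ r) ⦃ >-nonZero (m≤n+m 1 (2 * r)) ⦄ y<window-end , m+[n∸m]≡n (m≤n+o⇒m∸n≤o a r a≤r+y)
  where
  width : ∀ b r → suc (r + (r + b)) ≡ b + (2 * r + 1)
  width = solve-∀
  y<window-end : y < a ∸ r + (2 * r + 1)
  y<window-end = ≤-trans (s≤s (≤-trans y≤r+a (+-monoʳ-≤ r (m≤n+m∸n a r))))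
                         (≤-reflexive (width (a ∸ r) r))

mainTheorem14 : (G : Graph) (c r : ℕ) → 1 ≤ c → (w : Fin c → Fin (n G))
    → (∀ v → ∃[ i ] DistLe G v (w i) r)
    → ∀ ℓ → LayeredTreewidthLe G ℓ
    → TreewidthLe G ((2 * r + 1) * c * ℓ ∸ 1)
mainTheorem14 G c r _ w near ℓ (D , layer , isLayering , thin) = D , bagBound
  where
  layers : List ℕ
  layers = cartesianProductWith (λ d i → layer (w i) ∸ r + d) (upTo (2 * r + 1)) (allFin c)

  layer∈layers : ∀ v → layer v ∈ layers
  layer∈layers v with i , v~wi ← near v
    with below , above ← distLe⇒layers-close isLayering v~wi
    with d , d<2r+1 , offset ← ∃-offset-in-window r below above =
    subst (_∈ layers) offset (∈-cartesianProductWith⁺ _ (∈-upTo⁺ d<2r+1) (∈-allFin i))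

  bagBound : ∀ t → ∣ bag D t ∣ ≤ suc ((2 * r + 1) * c * ℓ ∸ 1)
  bagBound t = begin
    ∣ bag D t ∣                                           ≤⟨ ∣p∣≤sum∣p∩fibre∣ (bag D t) layer layers (λ _ → layer∈layers _) ⟩
    sum (map (λ k → ∣ bag D t ∩ layerSet G layer k ∣) layers) ≤⟨ sum-map-≤ _ ℓ layers (thin t) ⟩
    length layers * ℓ                                     ≡⟨ cong (_* ℓ) (length-cartesianProductWith _ (upTo (2 * r + 1)) (allFin c)) ⟩
    length (upTo (2 * r + 1)) * length (allFin c) * ℓ     ≡⟨ cong₂ (λ a b → a * b * ℓ) (length-upTo (2 * r + 1)) (length-tabulate _) ⟩
    (2 * r + 1) * c * ℓ                                   ≤⟨ m≤n+m∸n _ 1 ⟩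
    suc ((2 * r + 1) * c * ℓ ∸ 1)                         ∎
    where open ≤-Reasoning
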